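{- Let $F$ be a forest and let $i_1,i_2,\dots,i_m$ ($m\ge3$) be mutually distinct vertices of $F$, with indices taken modulo $m$. Suppose that for each $1\le s\le m$ there is a (necessarily unique) path $P_{s,s+1}$ in $F$ connecting $i_s$ and $i_{s+1}$, and denote by $e'_{s,s+1}$ and $e''_{s,s+1}$ the edges of $P_{s,s+1}$ incident to $i_s$ and to $i_{s+1}$, respectively. Suppose there exists $1\le t\le m$ with $e''_{t,t+1}\neq e'_{t+1,t+2}$. Then among the paths $P_{s,s+1}$ with $s\notin\{t,t+1\}$ there exist two paths $P_{a,a+1}$ and $P_{b,b+1}$ (not necessarily distinct), both of length at least $2$, such that $P_{a,a+1}$ contains $e''_{t,t+1}$ and $P_{b,b+1}$ contains $e'_{t+1,t+2}$.
   Context: Graphs are finite, simple and undirected. A forest is a graph with no cycles. A path is a sequence of distinct vertices with consecutive vertices adjacent; its length is its number of edges. -}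

module Defs where

open import Data.Nat using (ℕ; zero; suc; _≤_)
open import Data.Nat.DivMod using (_mod_)
open import Data.Fin using (Fin; zero; suc; toℕ; inject₁; fromℕ)
open import Data.Product using (_×_; _,_; Σ)
open import Data.Sum using (_⊎_)
open import Data.Empty using (⊥)
open import Relation.Nullary using (¬_)
open import Relation.Binary.PropositionalEquality using (_≡_)
open import Function.Definitions using (Injective)

nxt : ∀ {m} → Fin m → Fin m
nxt {suc m} i = suc (toℕ i) mod suc m

record Graph (n : ℕ) : Set₁ where
  field
    Adj   : Fin n → Fin n → Set
    sym   : ∀ {u v} → Adj u v → Adj v u
    irrefl : ∀ {u} → ¬ Adj u u
open Graph public

record Cycle {n} (G : Graph n) : Set where
  field
    len   : ℕ
    len≥3 : 3 ≤ len
    vert  : Fin len → Fin n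
    inj   : Injective _≡_ _≡_ vert
    adj   : ∀ j → Adj G (vert j) (vert (nxt j))

Forest : ∀ {n} → Graph n → Set
Forest G = ¬ Cycle G

record Path {n} (G : Graph n) (u v : Fin n) : Set where
  field
    len   : ℕ
    vert  : Fin (suc len) → Fin n
    inj   : Injective _≡_ _≡_ vert
    adj   : ∀ (j : Fin len) → Adj G (vert (inject₁ j)) (vert (suc j))
    start : vert zero ≡ u
    end   : vert (fromℕ len) ≡ v
open Path public

-- edges are represented by ordered pairs, compared as unordered pairs
Edge : ℕ → Set
Edge n = Fin n × Fin n

SameEdge : ∀ {n} → Edge n → Edge n → Set
SameEdge (a , b) (c , d) = (a ≡ c × b ≡ d) ⊎ (a ≡ d × b ≡ c)

Contains : ∀ {n} {G : Graph n} {u v} → Path G u v → Edge n → Set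
Contains P e = Σ (Fin (len P)) λ j → SameEdge (vert P (inject₁ j) , vert P (suc j)) e

private
  firstE : ∀ {n} (k : ℕ) → (Fin (suc k) → Fin n) → Edge n
  firstE zero    f = f zero , f zero          -- degenerate (length-0 path); never used
  firstE (suc k) f = f zero , f (suc zero)

  lastE : ∀ {n} (k : ℕ) → (Fin (suc k) → Fin n) → Edge n
  lastE zero    f = f zero , f zero           -- degenerate (length-0 path); never used
  lastE (suc k) f = f (inject₁ (fromℕ k)) , f (fromℕ (suc k))

firstEdge : ∀ {n} {G : Graph n} {u v} → Path G u v → Edge n
firstEdge P = firstE (len P) (vert P)

lastEdge : ∀ {n} {G : Graph n} {u v} → Path G u v → Edge n
lastEdge P = lastE (len P) (vert P)

-- Write x = i (t+1). The paths P s with s ∉ {t, t+1} concatenate to a walk from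
-- i (t+2) back to i t. If none of them used e'' = e''_{t,t+1} = {y, x}, then
-- P (t+1) (which leaves x along an edge other than e'' and never returns to x),
-- this walk, and P t without its last edge would form a walk from x to y
-- avoiding the edge {y, x}; shortened to a path it closes a cycle, impossible
-- in a forest. The case of e' is symmetric. Finally, a path that contains an
-- edge at x but does not end at x must have length at least 2.
module Submission where

open import Defs hiding (sym)
open import Data.Nat using (ℕ; zero; suc; _+_; _∸_; _≤_; _%_; s≤s; z≤n; NonZero)
open import Data.Nat.Properties
  using (+-identityʳ; +-suc; +-assoc; m+[n∸m]≡n; m∸n+n≡m; <⇒≤; ≤-trans; n≤1+n)
open import Data.Nat.DivMod using (%-distribˡ-+; m%n%n≡m%n; %-remove-+ˡ; m<n⇒m%n≡m; n%n≡0)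
open import Data.Nat.Divisibility using (∣-refl)
open import Data.Fin using (Fin; zero; suc; toℕ; inject₁; fromℕ)
open import Data.Fin.Properties
  using (toℕ-fromℕ<; toℕ-injective; toℕ<n; toℕ-inject₁; toℕ-fromℕ; fromℕ≢inject₁; 0≢1+n; _≟_; any?)
open import Data.Product using (Σ; _×_; _,_; proj₁; proj₂)
open import Data.Sum using (_⊎_; inj₁; inj₂; [_,_]′; swap)
open import Data.Unit using (⊤; tt)
open import Function using (_∘_; id)
open import Function.Definitions using (Injective)
open import Relation.Nullary using (¬_; Dec; yes; no; ¬?; contradiction)
open import Relation.Nullary.Decidable using (_×-dec_; _⊎-dec_)
open import Relation.Binary.PropositionalEquality

[m%d+n]%d≡[m+n]%d : ∀ m n d .{{_ : NonZero d}} → (m % d + n) % d ≡ (m + n) % d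
[m%d+n]%d≡[m+n]%d m n d = begin
  (m % d + n) % d          ≡⟨ %-distribˡ-+ (m % d) n d ⟩
  (m % d % d + n % d) % d  ≡⟨ cong (λ r → (r + n % d) % d) (m%n%n≡m%n m d) ⟩
  (m % d + n % d) % d      ≡⟨ %-distribˡ-+ m n d ⟨
  (m + n) % d              ∎
  where open ≡-Reasoning

toℕ-nxt : ∀ {m} (s : Fin (suc m)) → toℕ (nxt s) ≡ suc (toℕ s) % suc m
toℕ-nxt s = toℕ-fromℕ< _

nxt^ : ∀ {m} → ℕ → Fin m → Fin m
nxt^ zero    s = s
nxt^ (suc k) s = nxt^ k (nxt s)

toℕ-nxt^ : ∀ {m} k (s : Fin (suc m)) → toℕ (nxt^ k s) ≡ (toℕ s + k) % suc m
toℕ-nxt^ {m} zero s = begin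
  toℕ s               ≡⟨ m<n⇒m%n≡m (toℕ<n s) ⟨
  toℕ s % suc m       ≡⟨ cong (_% suc m) (+-identityʳ (toℕ s)) ⟨
  (toℕ s + 0) % suc m ∎
  where open ≡-Reasoning
toℕ-nxt^ {m} (suc k) s = begin
  toℕ (nxt^ k (nxt s))              ≡⟨ toℕ-nxt^ k (nxt s) ⟩
  (toℕ (nxt s) + k) % suc m         ≡⟨ cong (λ r → (r + k) % suc m) (toℕ-nxt s) ⟩
  (suc (toℕ s) % suc m + k) % suc m ≡⟨ [m%d+n]%d≡[m+n]%d (suc (toℕ s)) k (suc m) ⟩
  (suc (toℕ s) + k) % suc m         ≡⟨ cong (_% suc m) (+-suc (toℕ s) k) ⟨
  (toℕ s + suc k) % suc m           ∎
  where open ≡-Reasoning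

nxt^-reaches : ∀ {m} (s u : Fin m) → nxt^ (m ∸ toℕ s + toℕ u) s ≡ u
nxt^-reaches {suc m} s u = toℕ-injective (begin
  toℕ (nxt^ (suc m ∸ toℕ s + toℕ u) s)       ≡⟨ toℕ-nxt^ (suc m ∸ toℕ s + toℕ u) s ⟩
  (toℕ s + (suc m ∸ toℕ s + toℕ u)) % suc m  ≡⟨ cong (_% suc m) (+-assoc (toℕ s) _ (toℕ u)) ⟨
  (toℕ s + (suc m ∸ toℕ s) + toℕ u) % suc m  ≡⟨ cong (λ r → (r + toℕ u) % suc m) (m+[n∸m]≡n (<⇒≤ (toℕ<n s))) ⟩
  (suc m + toℕ u) % suc m                    ≡⟨ %-remove-+ˡ (toℕ u) ∣-refl ⟩
  toℕ u % suc m                              ≡⟨ m<n⇒m%n≡m (toℕ<n u) ⟩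
  toℕ u                                      ∎)
  where open ≡-Reasoning

nxt^-period : ∀ {m} (s : Fin m) → nxt^ m s ≡ s
nxt^-period {m} s = subst (λ k → nxt^ k s ≡ s) (m∸n+n≡m (<⇒≤ (toℕ<n s))) (nxt^-reaches s s)

nxt-injective : ∀ {m} → Injective _≡_ _≡_ (nxt {m})
nxt-injective {suc m} {a} {b} eq = begin
  a                ≡⟨ nxt^-period a ⟨
  nxt^ m (nxt a)   ≡⟨ cong (nxt^ m) eq ⟩
  nxt^ m (nxt b)   ≡⟨ nxt^-period b ⟩
  b                ∎
  where open ≡-Reasoning

nxt-induction : ∀ {m} (Q : Fin m → Set) {s u : Fin m} →
                Q s → (∀ c → c ≢ u → Q c → Q (nxt c)) → Q u
nxt-induction {m} Q {s} {u} Qs extend = go (m ∸ toℕ s + toℕ u) (nxt^-reaches s u) Qs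
  where
    go : ∀ k {c} → nxt^ k c ≡ u → Q c → Q u
    go zero    refl Qc = Qc
    go (suc k) {c} reaches Qc with c ≟ u
    ... | yes refl = Qc
    ... | no c≢u   = go k reaches (extend c c≢u Qc)

nxt-moves : ∀ {m} → 2 ≤ m → (s : Fin m) → nxt s ≢ s
nxt-moves {suc (suc m)} _ s fixed = 0≢1+n (trans (everywhere zero) (sym (everywhere (suc zero))))
  where
    everywhere : ∀ u → u ≡ s
    everywhere u = nxt-induction (_≡ s) {s} {u} refl (λ c _ c≡s → trans (cong nxt c≡s) fixed)
nxt-moves {suc zero} (s≤s ()) _

nxt-inject₁ : ∀ {k} (j : Fin k) → nxt (inject₁ j) ≡ suc j
nxt-inject₁ {k} j = toℕ-injective (begin
  toℕ (nxt (inject₁ j))         ≡⟨ toℕ-nxt (inject₁ j) ⟩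
  suc (toℕ (inject₁ j)) % suc k ≡⟨ cong (λ r → suc r % suc k) (toℕ-inject₁ j) ⟩
  suc (toℕ j) % suc k           ≡⟨ m<n⇒m%n≡m (s≤s (toℕ<n j)) ⟩
  suc (toℕ j)                   ∎)
  where open ≡-Reasoning

nxt-fromℕ : ∀ k → nxt (fromℕ k) ≡ zero
nxt-fromℕ k = toℕ-injective (begin
  toℕ (nxt (fromℕ k))         ≡⟨ toℕ-nxt (fromℕ k) ⟩
  suc (toℕ (fromℕ k)) % suc k ≡⟨ cong (λ r → suc r % suc k) (toℕ-fromℕ k) ⟩
  suc k % suc k               ≡⟨ n%n≡0 (suc k) ⟩
  0                           ∎)
  where open ≡-Reasoning

data LastOrInject₁ : ∀ {k} → Fin (suc k) → Set where
  inner : ∀ {k} (j : Fin k) → LastOrInject₁ (inject₁ j)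
  last  : ∀ {k} → LastOrInject₁ (fromℕ k)

lastOrInject₁ : ∀ {k} (j : Fin (suc k)) → LastOrInject₁ j
lastOrInject₁ {zero}  zero    = last
lastOrInject₁ {suc k} zero    = inner zero
lastOrInject₁ {suc k} (suc j) with lastOrInject₁ j
... | inner j′ = inner (suc j′)
... | last     = last

Incident : ∀ {n} → Fin n → Edge n → Set
Incident x (a , b) = a ≡ x ⊎ b ≡ x

SameEdge-sym : ∀ {n} {e e′ : Edge n} → SameEdge e e′ → SameEdge e′ e
SameEdge-sym (inj₁ (refl , refl)) = inj₁ (refl , refl)
SameEdge-sym (inj₂ (refl , refl)) = inj₂ (refl , refl)

Incident-resp-SameEdge : ∀ {n} {x : Fin n} {e e′} → SameEdge e e′ → Incident x e′ → Incident x e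
Incident-resp-SameEdge (inj₁ (refl , refl)) = id
Incident-resp-SameEdge (inj₂ (refl , refl)) = swap

¬Incident⇒¬SameEdge : ∀ {n} {x : Fin n} {e e′} → ¬ Incident x e → Incident x e′ → ¬ SameEdge e e′
¬Incident⇒¬SameEdge x∉e x∈e′ same = x∉e (Incident-resp-SameEdge same x∈e′)

sameEdge? : ∀ {n} (e e′ : Edge n) → Dec (SameEdge e e′)
sameEdge? (a , b) (c , d) = ((a ≟ c) ×-dec (b ≟ d)) ⊎-dec ((a ≟ d) ×-dec (b ≟ c))

contains? : ∀ {n} {G : Graph n} {u v} (P : Path G u v) (e : Edge n) → Dec (Contains P e)
contains? P e = any? (λ j → sameEdge? _ e)

data WalkAvoiding {n} (G : Graph n) (e : Edge n) : Fin n → Fin n → Set where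
  []   : ∀ {u} → WalkAvoiding G e u u
  step : ∀ {u w v} → Adj G u w → ¬ SameEdge (u , w) e → WalkAvoiding G e w v → WalkAvoiding G e u v

module _ {n} {G : Graph n} {e : Edge n} where

  infixr 5 _++_
  _++_ : ∀ {u v w} → WalkAvoiding G e u v → WalkAvoiding G e v w → WalkAvoiding G e u w
  []            ++ q = q
  step uw ne p  ++ q = step uw ne (p ++ q)

  length : ∀ {u v} → WalkAvoiding G e u v → ℕ
  length []           = 0
  length (step _ _ p) = suc (length p)

  vertex : ∀ {u v} (p : WalkAvoiding G e u v) → Fin (suc (length p)) → Fin n
  vertex {u} []           _       = u
  vertex {u} (step _ _ p) zero    = u
  vertex     (step _ _ p) (suc j) = vertex p j

  vertex-zero : ∀ {u v} (p : WalkAvoiding G e u v) → vertex p zero ≡ u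
  vertex-zero []           = refl
  vertex-zero (step _ _ _) = refl

  vertex-last : ∀ {u v} (p : WalkAvoiding G e u v) → vertex p (fromℕ (length p)) ≡ v
  vertex-last []           = refl
  vertex-last (step _ _ p) = vertex-last p

  vertex-adj : ∀ {u v} (p : WalkAvoiding G e u v) (j : Fin (length p)) →
               Adj G (vertex p (inject₁ j)) (vertex p (suc j))
  vertex-adj (step uw _ p) zero    = subst (Adj G _) (sym (vertex-zero p)) uw
  vertex-adj (step _ _ p)  (suc j) = vertex-adj p j

  Distinct : ∀ {u v} → WalkAvoiding G e u v → Set
  Distinct []               = ⊤
  Distinct {u} (step _ _ p) = (∀ j → vertex p j ≢ u) × Distinct p

  vertex-injective : ∀ {u v} (p : WalkAvoiding G e u v) → Distinct p → Injective _≡_ _≡_ (vertex p)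
  vertex-injective []           _        {zero}  {zero}  _  = refl
  vertex-injective (step _ _ p) _        {zero}  {zero}  _  = refl
  vertex-injective (step _ _ p) (new , _) {zero}  {suc j} eq = contradiction (sym eq) (new j)
  vertex-injective (step _ _ p) (new , _) {suc i} {zero}  eq = contradiction eq (new i)
  vertex-injective (step _ _ p) (_ , dp)  {suc i} {suc j} eq = cong suc (vertex-injective p dp eq)

  suffixFrom : ∀ {u v a} (p : WalkAvoiding G e u v) → Distinct p →
               ∀ j → vertex p j ≡ a → Σ (WalkAvoiding G e a v) Distinct
  suffixFrom []           dp       zero    refl = [] , dp
  suffixFrom (step s ne p) dp      zero    refl = step s ne p , dp
  suffixFrom (step _ _ p) (_ , dp) (suc j) pj≡a = suffixFrom p dp j pj≡a

  shortcut : ∀ {u v} → WalkAvoiding G e u v → Σ (WalkAvoiding G e u v) Distinct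
  shortcut [] = [] , tt
  shortcut {u} (step uw ne p) with shortcut p
  ... | q , dq with any? (λ j → vertex q j ≟ u)
  ... | yes (j , qj≡u) = suffixFrom q dq j qj≡u
  ... | no  u∉q        = step uw ne q , (λ j qj≡u → u∉q (j , qj≡u)) , dq

edge-isBridge : ∀ {n} {G : Graph n} → Forest G → ∀ {a b} → Adj G a b → ¬ WalkAvoiding G (a , b) b a
edge-isBridge {G = G} forest {a} ab w with shortcut w
... | [] , _                        = irrefl G ab
... | step _ ba≢ab [] , _           = ba≢ab (inj₂ (refl , refl))
... | q@(step _ _ (step _ _ _)) , dq = forest record
  { len = suc (length q) ; len≥3 = s≤s (s≤s (s≤s z≤n))
  ; vert = vertex q ; inj = vertex-injective q dq ; adj = closing }
  where
    closing : ∀ j → Adj G (vertex q j) (vertex q (nxt j))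
    closing j with lastOrInject₁ j
    ... | inner j′ = subst (Adj G (vertex q (inject₁ j′)) ∘ vertex q) (sym (nxt-inject₁ j′)) (vertex-adj q j′)
    ... | last     = subst₂ (Adj G) (sym (vertex-last q)) (cong (vertex q) (sym (nxt-fromℕ (length q)))) ab

module _ {n} {G : Graph n} where

  sequenceWalk : ∀ {e} k (f : Fin (suc k) → Fin n) →
                 (∀ j → Adj G (f (inject₁ j)) (f (suc j))) →
                 (∀ j → ¬ SameEdge (f (inject₁ j) , f (suc j)) e) →
                 WalkAvoiding G e (f zero) (f (fromℕ k))
  sequenceWalk zero    f _     _     = []
  sequenceWalk (suc k) f f-adj avoid =
    step (f-adj zero) (avoid zero) (sequenceWalk k (f ∘ suc) (f-adj ∘ suc) (avoid ∘ suc))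

  Path⇒WalkAvoiding : ∀ {u v e} (P : Path G u v) → ¬ Contains P e → WalkAvoiding G e u v
  Path⇒WalkAvoiding P e∉P =
    subst₂ (WalkAvoiding G _) (start P) (end P)
      (sequenceWalk (len P) (vert P) (adj P) (λ j same → e∉P (j , same)))

  vert-suc≢start : ∀ {u v} (P : Path G u v) j → vert P (suc j) ≢ u
  vert-suc≢start P j eq with inj P (trans eq (sym (start P)))
  ... | ()

  vert-inject₁≢end : ∀ {u v} (P : Path G u v) j → vert P (inject₁ j) ≢ v
  vert-inject₁≢end P j eq = fromℕ≢inject₁ (sym (inj P (trans eq (sym (end P)))))

  dropFirstEdge : ∀ {u v e} (P : Path G u v) → Incident u e →
                  WalkAvoiding G e (proj₂ (firstEdge P)) v
  dropFirstEdge P@record { len = zero } _ = subst₂ (WalkAvoiding G _) refl (end P) []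
  dropFirstEdge P@record { len = suc l } u∈e =
    subst₂ (WalkAvoiding G _) refl (end P)
      (sequenceWalk l (vert P ∘ suc) (adj P ∘ suc) λ j →
        ¬Incident⇒¬SameEdge [ vert-suc≢start P (inject₁ j) , vert-suc≢start P (suc j) ]′ u∈e)

  dropLastEdge : ∀ {u v e} (P : Path G u v) → Incident v e →
                 WalkAvoiding G e u (proj₁ (lastEdge P))
  dropLastEdge P@record { len = zero } _ = subst₂ (WalkAvoiding G _) (start P) refl []
  dropLastEdge P@record { len = suc k } v∈e =
    subst₂ (WalkAvoiding G _) (start P) refl
      (sequenceWalk k (vert P ∘ inject₁) (adj P ∘ inject₁) λ j →
        ¬Incident⇒¬SameEdge [ vert-inject₁≢end P (inject₁ j) , vert-inject₁≢end P (suc j) ]′ v∈e)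

  fromStart-avoiding : ∀ {u v e} (P : Path G u v) → Incident u e → ¬ SameEdge (firstEdge P) e →
                       WalkAvoiding G e u v
  fromStart-avoiding P@record { len = zero }  _   _   = subst₂ (WalkAvoiding G _) (start P) (end P) []
  fromStart-avoiding P@record { len = suc _ } u∈e ne =
    subst₂ (WalkAvoiding G _) (start P) refl (step (adj P zero) ne (dropFirstEdge P u∈e))

  toEnd-avoiding : ∀ {u v e} (P : Path G u v) → Incident v e → ¬ SameEdge (lastEdge P) e →
                   WalkAvoiding G e u v
  toEnd-avoiding P@record { len = zero }  _   _   = subst₂ (WalkAvoiding G _) (start P) (end P) []
  toEnd-avoiding P@record { len = suc k } v∈e ne =
    subst₂ (WalkAvoiding G _) refl (end P) (dropLastEdge P v∈e ++ step (adj P (fromℕ k)) ne [])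

  firstEdge-incident : ∀ {u v} (P : Path G u v) → u ≢ v → Incident u (firstEdge P)
  firstEdge-incident P@record { len = zero }  u≢v = contradiction (trans (sym (start P)) (end P)) u≢v
  firstEdge-incident P@record { len = suc _ } _   = inj₁ (start P)

  lastEdge-incident : ∀ {u v} (P : Path G u v) → u ≢ v → Incident v (lastEdge P)
  lastEdge-incident P@record { len = zero }  u≢v = contradiction (trans (sym (start P)) (end P)) u≢v
  lastEdge-incident P@record { len = suc _ } _   = inj₂ (end P)

  firstEdge-separates : ∀ {u v} → Forest G → (P : Path G u v) → u ≢ v →
                        ¬ WalkAvoiding G (firstEdge P) v u
  firstEdge-separates _      P@record { len = zero }  u≢v _ = u≢v (trans (sym (start P)) (end P))
  firstEdge-separates forest P@record { len = suc _ } u≢v w =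
    edge-isBridge forest (adj P zero)
      (dropFirstEdge P (firstEdge-incident P u≢v) ++ subst₂ (WalkAvoiding G _) refl (sym (start P)) w)

  lastEdge-separates : ∀ {u v} → Forest G → (P : Path G u v) → u ≢ v →
                       ¬ WalkAvoiding G (lastEdge P) v u
  lastEdge-separates _      P@record { len = zero }  u≢v _ = u≢v (trans (sym (start P)) (end P))
  lastEdge-separates forest P@record { len = suc k } u≢v w =
    edge-isBridge forest (adj P (fromℕ k))
      (subst₂ (WalkAvoiding G _) (sym (end P)) refl w ++ dropLastEdge P (lastEdge-incident P u≢v))

  Contains-incident⇒2≤len : ∀ {u v x e} (P : Path G u v) → u ≢ x → v ≢ x →
                             Incident x e → Contains P e → 2 ≤ len P
  Contains-incident⇒2≤len record { len = zero }        _   _   _   (() , _)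
  Contains-incident⇒2≤len P@record { len = suc zero }  u≢x v≢x x∈e (zero , same) =
    contradiction (Incident-resp-SameEdge same x∈e)
      [ u≢x ∘ trans (sym (start P)) , v≢x ∘ trans (sym (end P)) ]′
  Contains-incident⇒2≤len record { len = suc (suc _) } _   _   _   _ = s≤s (s≤s z≤n)

module _ {n} {G : Graph n} {m} {i : Fin m → Fin n}
         (P : ∀ s → Path G (i s) (i (nxt s))) (t : Fin m) where

  ArcPathThrough : Edge n → Fin m → Set
  ArcPathThrough e a = ¬ a ≡ t × ¬ a ≡ nxt t × 2 ≤ len (P a) × Contains (P a) e

  arcWalk : 2 ≤ m → ∀ {e} → (∀ s → s ≢ t → s ≢ nxt t → ¬ Contains (P s) e) →
            WalkAvoiding G e (i (nxt (nxt t))) (i t)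
  arcWalk 2≤m {e} e∉arc =
    nxt-induction Reach {nxt (nxt t)} {t} (λ _ → []) extend (nxt-moves 2≤m t ∘ sym)
    where
      -- Reach is vacuous at t+1.
      Reach : Fin m → Set
      Reach c = c ≢ nxt t → WalkAvoiding G e (i (nxt (nxt t))) (i c)

      extend : ∀ c → c ≢ t → Reach c → Reach (nxt c)
      extend c c≢t reach _ with c ≟ nxt t
      ... | yes refl  = []
      ... | no c≢t+1 = reach c≢t+1 ++ Path⇒WalkAvoiding (P c) (e∉arc c c≢t c≢t+1)

  usedOnArc : 2 ≤ m → Injective _≡_ _≡_ i → ∀ {e} → Incident (i (nxt t)) e →
              ¬ WalkAvoiding G e (i (nxt (nxt t))) (i t) → Σ (Fin m) (ArcPathThrough e)
  usedOnArc 2≤m i-inj {e} x∈e no-arc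
    with any? (λ s → ¬? (s ≟ t) ×-dec ¬? (s ≟ nxt t) ×-dec contains? (P s) e)
  ... | yes (a , a≢t , a≢t+1 , e∈Pa) =
    a , a≢t , a≢t+1 ,
    Contains-incident⇒2≤len (P a) (a≢t+1 ∘ i-inj) (a≢t ∘ nxt-injective ∘ i-inj) x∈e e∈Pa , e∈Pa
  ... | no none = contradiction (arcWalk 2≤m λ s s≢t s≢t+1 e∈Ps → none (s , s≢t , s≢t+1 , e∈Ps)) no-arc

lemma5p11 : ∀ {n} (G : Graph n) → Forest G →
    (m : ℕ) → 3 ≤ m →
    (i : Fin m → Fin n) → Injective _≡_ _≡_ i →
    (P : (s : Fin m) → Path G (i s) (i (nxt s))) →
    (t : Fin m) → ¬ SameEdge (lastEdge (P t)) (firstEdge (P (nxt t))) →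
    Σ (Fin m) λ a → Σ (Fin m) λ b →
      (¬ a ≡ t × ¬ a ≡ nxt t × 2 ≤ len (P a) × Contains (P a) (lastEdge (P t)))
      × (¬ b ≡ t × ¬ b ≡ nxt t × 2 ≤ len (P b) × Contains (P b) (firstEdge (P (nxt t))))
lemma5p11 G forest m 3≤m i i-inj P t e″≢e′ = proj₁ A , proj₁ B , proj₂ A , proj₂ B
  where
    2≤m : 2 ≤ m
    2≤m = ≤-trans (n≤1+n 2) 3≤m

    u≢x : i t ≢ i (nxt t)
    u≢x = nxt-moves 2≤m t ∘ sym ∘ i-inj

    x≢w : i (nxt t) ≢ i (nxt (nxt t))
    x≢w = nxt-moves 2≤m (nxt t) ∘ sym ∘ i-inj

    x∈e″ : Incident (i (nxt t)) (lastEdge (P t))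
    x∈e″ = lastEdge-incident (P t) u≢x

    x∈e′ : Incident (i (nxt t)) (firstEdge (P (nxt t)))
    x∈e′ = firstEdge-incident (P (nxt t)) x≢w

    A : Σ (Fin m) (ArcPathThrough P t (lastEdge (P t)))
    A = usedOnArc P t 2≤m i-inj x∈e″ λ arc →
          lastEdge-separates forest (P t) u≢x
            (fromStart-avoiding (P (nxt t)) x∈e″ (e″≢e′ ∘ SameEdge-sym) ++ arc)

    B : Σ (Fin m) (ArcPathThrough P t (firstEdge (P (nxt t))))
    B = usedOnArc P t 2≤m i-inj x∈e′ λ arc →
          firstEdge-separates forest (P (nxt t)) x≢w
            (arc ++ toEnd-avoiding (P t) x∈e′ e″≢e′)
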